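{- Let $s\ge0$ and let $G=G(S,h_1,h_2)$ be a cuckoo graph with $\mathrm{ex}(G)\ge s+1$. Then $G$ contains an excess-$(s+1)$ core graph as a subgraph.
   Context: For $S\subseteq U$ and $h_1,h_2\colon U\to[m]$, the cuckoo graph $G(S,h_1,h_2)$ is the bipartite multigraph with two vertex sides being copies of $[m]$ and edges $(h_1(x),h_2(x))$, $x\in S$. The excess $\mathrm{ex}(G)$ is the minimum number of edges one has to remove from $G$ so that every connected component of the remaining graph is acyclic or unicyclic. A leaf is a node of degree 1; leafless means having no leaves. The cyclomatic number of a component is the minimum number of its edges whose removal leaves it acyclic. An excess-$(s+1)$ core graph is a leafless graph with excess exactly $s+1$ in which every connected component (ignoring isolated vertices) has cyclomatic number at least $2$ (i.e., at least two cycles). -}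

module Defs where

open import Data.Nat using (ℕ; zero; suc; _≤_; _+_)
open import Data.Fin using (Fin)
open import Data.Fin.Properties using (_≟_)
open import Data.Fin.Subset using (Subset; _∈_; ∁; ∣_∣; Nonempty)
open import Data.Bool using (true; false)
import Data.Vec as V
open import Data.List using (List; []; _∷_; length; map; lookup)
open import Data.List.Relation.Unary.Unique.Propositional using (Unique)
open import Data.Product using (_×_; _,_; proj₁; proj₂; Σ; ∃; ∃-syntax)
open import Data.Sum using (_⊎_; inj₁; inj₂)
open import Relation.Binary.PropositionalEquality using (_≡_; _≢_)
open import Relation.Nullary using (¬_; yes; no)
open import Function.Bundles using (_⇔_)

-- A bipartite multigraph on two copies of [m] = Fin m, given by its list of
-- edges (left endpoint, right endpoint).  Parallel edges are allowed.
Graph : ℕ → Set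
Graph m = List (Fin m × Fin m)

-- Vertices: inj₁ a is the left copy of a, inj₂ b the right copy of b.
Vertex : ℕ → Set
Vertex m = Fin m ⊎ Fin m

cuckooGraph : {U : Set} {m : ℕ} → List U → (U → Fin m) → (U → Fin m) → Graph m
cuckooGraph S h₁ h₂ = map (λ x → h₁ x , h₂ x) S

restrict : {m : ℕ} (H : Graph m) → Subset (length H) → Graph m
restrict []      V.[]          = []
restrict (e ∷ H) (true V.∷ p)  = e ∷ restrict H p
restrict (e ∷ H) (false V.∷ p) = restrict H p

Joins : {m : ℕ} → Fin m × Fin m → Vertex m → Vertex m → Set
Joins (a , b) u w = (u ≡ inj₁ a × w ≡ inj₂ b) ⊎ (u ≡ inj₂ b × w ≡ inj₁ a)

data Walk {m : ℕ} (H : Graph m) : Vertex m → Vertex m → List (Fin (length H)) → Set where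
  []   : {v : Vertex m} → Walk H v v []
  step : {u w x : Vertex m} {is : List (Fin (length H))} (i : Fin (length H)) →
         Joins (lookup H i) u w → Walk H w x is → Walk H u x (i ∷ is)

HasCycle : {m : ℕ} → Graph m → Set
HasCycle {m} H = Σ (Vertex m) λ v → Σ (List (Fin (length H))) λ is →
  (is ≢ []) × Unique is × Walk H v v is

Acyclic : {m : ℕ} → Graph m → Set
Acyclic H = ¬ HasCycle H

Connected : {m : ℕ} → Graph m → Vertex m → Vertex m → Set
Connected H u w = ∃ λ is → Walk H u w is

-- C is (the edge set of) the connected component of H containing v.
IsComponent : {m : ℕ} (H : Graph m) → Vertex m → Subset (length H) → Set
IsComponent H v C = ∀ i → (i ∈ C) ⇔ Connected H v (inj₁ (proj₁ (lookup H i)))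

IsMinRemoval : {m : ℕ} → (Graph m → Set) → Graph m → ℕ → Set
IsMinRemoval P H k =
  (Σ (Subset (length H)) λ R → ∣ R ∣ ≡ k × P (restrict H (∁ R))) ×
  (∀ (R : Subset (length H)) → P (restrict H (∁ R)) → k ≤ ∣ R ∣)

IsCyclomaticNumber : {m : ℕ} → Graph m → ℕ → Set
IsCyclomaticNumber = IsMinRemoval Acyclic

AcyclicOrUnicyclicComponents : {m : ℕ} → Graph m → Set
AcyclicOrUnicyclicComponents {m} H =
  ∀ (v : Vertex m) (C : Subset (length H)) → IsComponent H v C →
    ∃[ k ] (IsCyclomaticNumber (restrict H C) k × k ≤ 1)

IsExcess : {m : ℕ} → Graph m → ℕ → Set
IsExcess = IsMinRemoval AcyclicOrUnicyclicComponents

degree : {m : ℕ} → Graph m → Vertex m → ℕ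
degree [] v = 0
degree ((a , b) ∷ H) (inj₁ x) with a ≟ x
... | yes _ = suc (degree H (inj₁ x))
... | no  _ = degree H (inj₁ x)
degree ((a , b) ∷ H) (inj₂ y) with b ≟ y
... | yes _ = suc (degree H (inj₂ y))
... | no  _ = degree H (inj₂ y)

Leafless : {m : ℕ} → Graph m → Set
Leafless {m} H = ∀ (v : Vertex m) → degree H v ≢ 1

IsCoreGraph : {m : ℕ} → ℕ → Graph m → Set
IsCoreGraph {m} s K =
  Leafless K × IsExcess K (suc s) ×
  (∀ (v : Vertex m) (C : Subset (length K)) → IsComponent K v C → Nonempty C →
     ∃[ k ] (IsCyclomaticNumber (restrict K C) k × 2 ≤ k))

-- Delete edges of G one at a time as long as the excess stays above s, until no single
-- edge can be deleted; call the remaining edge set K. For every edge j of K some set R of at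
-- most s edges repairs K - j (leaves only acyclic or unicyclic components), and then
-- R ∪ {j} repairs K, so ex(K) = s + 1. If j were a leaf edge of K, or lay in a component of
-- K with at most one cycle, then the component of j in K ─ R would still have at most one
-- cycle (a leaf edge lies on no cycle; a subgraph of a unicyclic graph is at most unicyclic),
-- so R alone would repair K, contradicting ex(K) > s. Hence K is leafless and its nontrivial
-- components have cyclomatic number at least 2. All notions involved are decidable by finite
-- search, which makes the choices of K and of the minima constructive.

module Submission where

open import Defs
open import Data.Bool using (true; false)
open import Data.Empty using (⊥-elim)
open import Data.Fin using (Fin; zero; suc)
import Data.Fin.Properties as Fin
open import Data.Fin.Properties using (_≟_; any?; all?; injective⇒≤)
open import Data.Fin.Subset
  using (Subset; _∈_; _∉_; _⊆_; _⊂_; Nonempty; ∣_∣; ∁; ⊤; ⊥; _─_; _-_; _∪_; ⁅_⁆; inside; outside)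
open import Data.Fin.Subset.Properties
  using ( _∈?_; _⊆?_; nonempty?; anySubset?; drop-∷-⊆; ⊥⊆; ∈⊤; ∣⊥∣≡0; ∣⁅x⁆∣≡1; ∣p∣≤∣x∷p∣
        ; x∈⁅x⁆; x∈⁅y⁆⇒x≡y; x∈∁p⇒x∉p; x∉p⇒x∈∁p; x∈p∪q⁻; p─q⊆p; x∈p∧x∉q⇒x∈p─q
        ; x∈p∧x≢y⇒x∈p-y; p─q─r≡p─q∪r; p─q─r≡p─r─q; x∈p⇒p-x⊂p )
open import Data.Fin.Subset.Induction using (⊂-wellFounded)
open import Data.List using (List; []; _∷_; length; lookup; map; _++_; filter; allFin)
open import Data.List.Relation.Unary.All as All using (All; []; _∷_)
import Data.List.Relation.Unary.All.Properties as All
open import Data.List.Relation.Unary.Any as Any using (here; there)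
open import Data.List.Relation.Unary.Unique.Propositional using (Unique; []; _∷_)
import Data.List.Relation.Unary.Unique.Propositional.Properties as UniqueP
import Data.List.Membership.Propositional as List
import Data.List.Membership.Propositional.Properties as List
open import Data.Nat using (ℕ; zero; suc; _≤_; _<_; _+_; z≤n; s≤s)
open import Data.Nat.Induction using (<-wellFounded)
open import Data.Nat.Properties
  using ( _≤?_; _<?_; ≤-reflexive; ≤-trans; ≤-antisym; ≤-pred; ≰⇒>; ≤⇒≯; ≮⇒≥
        ; suc-injective; +-comm; +-suc; +-mono-≤; +-monoʳ-≤ )
open import Data.Unit using (tt)
open import Data.Product using (_×_; _,_; proj₁; proj₂; Σ; ∃; ∃-syntax)
open import Data.Sum using (_⊎_; inj₁; inj₂; [_,_]′)
import Data.Sum.Properties as Sum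
open import Data.Vec using ([]; _∷_; here; there)
open import Function.Base using (_∘_; id)
open import Function.Bundles using (_⇔_; mk⇔; Equivalence)
import Function.Properties.Equivalence as ⇔
open import Induction.WellFounded using (Acc; acc)
open import Relation.Binary.PropositionalEquality using (_≡_; _≢_; refl; sym; trans; cong; subst; ≢-sym)
open import Relation.Nullary using (¬_; Dec; yes; no; does)
open import Relation.Nullary.Decidable as Dec using (_×-dec_; _⊎-dec_; ¬?)

-- Finite search and subsets of Fin n

any-list≤? : ∀ {n} (k : ℕ) {P : List (Fin n) → Set} → (∀ xs → Dec (P xs)) →
             Dec (Σ (List (Fin n)) λ xs → length xs ≤ k × P xs)
any-list≤? zero P? with P? []
... | yes p = yes ([] , z≤n , p)
... | no ¬p = no λ { ([] , _ , p) → ¬p p ; (_ ∷ _ , () , _) }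
any-list≤? (suc k) P? with P? [] | any? (λ x → any-list≤? k (λ xs → P? (x ∷ xs)))
... | yes p  | _                    = yes ([] , z≤n , p)
... | no _   | yes (x , xs , l , p) = yes (x ∷ xs , s≤s l , p)
... | no ¬p  | no ¬q                = no λ { ([] , _ , p) → ¬p p
                                           ; (x ∷ xs , s≤s l , p) → ¬q (x , xs , l , p) }

unique⇒length≤ : ∀ {n} {xs : List (Fin n)} → Unique xs → length xs ≤ n
unique⇒length≤ u = injective⇒≤ (lookup-injective u)
  where
  lookup-injective : ∀ {A : Set} {ys : List A} → Unique ys → ∀ {a b} → lookup ys a ≡ lookup ys b → a ≡ b
  lookup-injective (_ ∷ _)  {zero}  {zero}  _  = refl
  lookup-injective (y∉ ∷ _) {zero}  {suc b} eq = ⊥-elim (All.lookup y∉ (List.∈-lookup b) eq)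
  lookup-injective (y∉ ∷ _) {suc a} {zero}  eq = ⊥-elim (All.lookup y∉ (List.∈-lookup a) (sym eq))
  lookup-injective (_ ∷ u)  {suc a} {suc b} eq = cong suc (lookup-injective u eq)

subsetOf : ∀ {n} {P : Fin n → Set} → (∀ i → Dec (P i)) → Subset n
subsetOf {zero}  _  = []
subsetOf {suc n} P? = does (P? zero) ∷ subsetOf (λ i → P? (suc i))

∈-subsetOf : ∀ {n} {P : Fin n → Set} (P? : ∀ i → Dec (P i)) {i} → i ∈ subsetOf P? ⇔ P i
∈-subsetOf P? = mk⇔ (to P? _) (from P? _)
  where
  to : ∀ {n} {P : Fin n → Set} (P? : ∀ i → Dec (P i)) i → i ∈ subsetOf P? → P i
  to P? zero i∈ with P? zero | i∈
  ... | yes p | _ = p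
  ... | no _  | ()
  to P? (suc i) (there i∈) = to (λ i → P? (suc i)) i i∈
  from : ∀ {n} {P : Fin n → Set} (P? : ∀ i → Dec (P i)) i → P i → i ∈ subsetOf P?
  from P? zero p with P? zero
  ... | yes _ = here
  ... | no ¬p = ⊥-elim (¬p p)
  from P? (suc i) p = there (from (λ i → P? (suc i)) i p)

∈─⇔ : ∀ {n} {p q : Subset n} {x} → x ∈ p ─ q ⇔ (x ∈ p × x ∉ q)
∈─⇔ {p = p} {q} = mk⇔ (λ x∈ → p─q⊆p p q x∈ , ∉q x∈) (λ (x∈p , x∉q) → x∈p∧x∉q⇒x∈p─q x∈p x∉q)
  where
  ∉q : ∀ {n} {p q : Subset n} {x} → x ∈ p ─ q → x ∉ q
  ∉q {p = _ ∷ p} {inside  ∷ q} (there x∈) (there x∈q) = ∉q x∈ x∈q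
  ∉q {p = _ ∷ p} {outside ∷ q} (there x∈) (there x∈q) = ∉q x∈ x∈q

∈-⇔ : ∀ {n} {p : Subset n} {x y} → x ∈ p - y ⇔ (x ∈ p × x ≢ y)
∈-⇔ {y = y} = mk⇔
  (λ x∈ → let x∈p , x∉⁅y⁆ = Equivalence.to ∈─⇔ x∈ in x∈p , λ { refl → x∉⁅y⁆ (x∈⁅x⁆ y) })
  (λ (x∈p , x≢y) → x∈p∧x≢y⇒x∈p-y x∈p x≢y)

∣p∪q∣≤∣p∣+∣q∣ : ∀ {n} (p q : Subset n) → ∣ p ∪ q ∣ ≤ ∣ p ∣ + ∣ q ∣
∣p∪q∣≤∣p∣+∣q∣ []            []            = z≤n
∣p∪q∣≤∣p∣+∣q∣ (inside  ∷ p) (b ∷ q)       =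
  s≤s (≤-trans (∣p∪q∣≤∣p∣+∣q∣ p q) (+-monoʳ-≤ ∣ p ∣ (∣p∣≤∣x∷p∣ b q)))
∣p∪q∣≤∣p∣+∣q∣ (outside ∷ p) (outside ∷ q) = ∣p∪q∣≤∣p∣+∣q∣ p q
∣p∪q∣≤∣p∣+∣q∣ (outside ∷ p) (inside  ∷ q) =
  ≤-trans (s≤s (∣p∪q∣≤∣p∣+∣q∣ p q)) (≤-reflexive (sym (+-suc ∣ p ∣ ∣ q ∣)))

∣p∣≤0⇒∉ : ∀ {n} (p : Subset n) → ∣ p ∣ ≤ 0 → ∀ {x} → x ∉ p
∣p∣≤0⇒∉ (inside  ∷ p) ()
∣p∣≤0⇒∉ (outside ∷ p) ∣p∣≤0 (there x∈p) = ∣p∣≤0⇒∉ p ∣p∣≤0 x∈p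

∣p∣≤1⇒subsingleton : ∀ {n} (p : Subset n) → ∣ p ∣ ≤ 1 → ∀ {x y} → x ∈ p → y ∈ p → x ≡ y
∣p∣≤1⇒subsingleton (inside  ∷ p) _           here      here      = refl
∣p∣≤1⇒subsingleton (inside  ∷ p) (s≤s ∣p∣≤0) here      (there y) = ⊥-elim (∣p∣≤0⇒∉ p ∣p∣≤0 y)
∣p∣≤1⇒subsingleton (inside  ∷ p) (s≤s ∣p∣≤0) (there x) _         = ⊥-elim (∣p∣≤0⇒∉ p ∣p∣≤0 x)
∣p∣≤1⇒subsingleton (outside ∷ p) ∣p∣≤1       (there x) (there y) =
  cong suc (∣p∣≤1⇒subsingleton p ∣p∣≤1 x y)

least-cardinality : ∀ {n} {D : Subset n → Set} → (∀ R → Dec (D R)) → ∀ R → D R →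
  Σ ℕ λ k → (Σ (Subset n) λ R → ∣ R ∣ ≡ k × D R) × (∀ R → D R → k ≤ ∣ R ∣)
least-cardinality {D = D} D? R = go R (<-wellFounded ∣ R ∣)
  where
  go : ∀ R → Acc _<_ ∣ R ∣ → D R →
       Σ ℕ λ k → (Σ _ λ R → ∣ R ∣ ≡ k × D R) × (∀ R → D R → k ≤ ∣ R ∣)
  go R (acc smaller) dR with anySubset? (λ R′ → D? R′ ×-dec (∣ R′ ∣ <? ∣ R ∣))
  ... | yes (R′ , dR′ , R′<R) = go R′ (smaller R′<R) dR′
  ... | no ∄smaller = ∣ R ∣ , (R , refl , dR) , λ R′ dR′ → ≮⇒≥ (λ R′<R → ∄smaller (R′ , dR′ , R′<R))

-- Endpoints and degrees

Ends : {m : ℕ} → Fin m × Fin m → Vertex m → Set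
Ends e v = v ≡ inj₁ (proj₁ e) ⊎ v ≡ inj₂ (proj₂ e)

module _ {m : ℕ} {e : Fin m × Fin m} where

  joins-sym : ∀ {u w} → Joins e u w → Joins e w u
  joins-sym (inj₁ (p , q)) = inj₂ (q , p)
  joins-sym (inj₂ (p , q)) = inj₁ (q , p)

  joins⇒endsˡ : ∀ {u w} → Joins e u w → Ends e u
  joins⇒endsˡ (inj₁ (p , _)) = inj₁ p
  joins⇒endsˡ (inj₂ (p , _)) = inj₂ p

  joins⇒endsʳ : ∀ {u w} → Joins e u w → Ends e w
  joins⇒endsʳ = joins⇒endsˡ ∘ joins-sym

  joins-irrefl : ∀ {u w} → Joins e u w → u ≢ w
  joins-irrefl (inj₁ (refl , refl)) ()
  joins-irrefl (inj₂ (refl , refl)) ()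

  ends⇒joins : ∀ {u} → Ends e u → ∃ (Joins e u)
  ends⇒joins (inj₁ refl) = _ , inj₁ (refl , refl)
  ends⇒joins (inj₂ refl) = _ , inj₂ (refl , refl)

  ends-of-joins : ∀ {u w x} → Joins e u w → Ends e x → x ≡ u ⊎ x ≡ w
  ends-of-joins (inj₁ (refl , refl)) (inj₁ refl) = inj₁ refl
  ends-of-joins (inj₁ (refl , refl)) (inj₂ refl) = inj₂ refl
  ends-of-joins (inj₂ (refl , refl)) (inj₁ refl) = inj₂ refl
  ends-of-joins (inj₂ (refl , refl)) (inj₂ refl) = inj₁ refl

degree≡0⇒¬ends : ∀ {m} (H : Graph m) v → degree H v ≡ 0 → ∀ i → ¬ Ends (lookup H i) v
degree≡0⇒¬ends ((a , b) ∷ H) (inj₁ x) eq i e with a ≟ x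
degree≡0⇒¬ends ((a , b) ∷ H) (inj₁ x) () i e | yes _
degree≡0⇒¬ends ((a , b) ∷ H) (inj₁ x) eq zero (inj₁ refl) | no a≢x = a≢x refl
degree≡0⇒¬ends ((a , b) ∷ H) (inj₁ x) eq (suc i) e | no _ = degree≡0⇒¬ends H (inj₁ x) eq i e
degree≡0⇒¬ends ((a , b) ∷ H) (inj₂ y) eq i e with b ≟ y
degree≡0⇒¬ends ((a , b) ∷ H) (inj₂ y) () i e | yes _
degree≡0⇒¬ends ((a , b) ∷ H) (inj₂ y) eq zero (inj₂ refl) | no b≢y = b≢y refl
degree≡0⇒¬ends ((a , b) ∷ H) (inj₂ y) eq (suc i) e | no _ = degree≡0⇒¬ends H (inj₂ y) eq i e

degree≡1⇒unique-end : ∀ {m} (H : Graph m) v → degree H v ≡ 1 →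
  Σ (Fin (length H)) λ j → Ends (lookup H j) v × (∀ i → Ends (lookup H i) v → i ≡ j)
degree≡1⇒unique-end ((a , b) ∷ H) (inj₁ x) eq with a ≟ x
... | yes refl = zero , inj₁ refl , λ
  { zero _ → refl ; (suc i) e → ⊥-elim (degree≡0⇒¬ends H (inj₁ x) (suc-injective eq) i e) }
... | no a≢x with degree≡1⇒unique-end H (inj₁ x) eq
...   | j , ej , only-j = suc j , ej , λ
  { zero (inj₁ refl) → ⊥-elim (a≢x refl) ; (suc i) e → cong suc (only-j i e) }
degree≡1⇒unique-end ((a , b) ∷ H) (inj₂ y) eq with b ≟ y
... | yes refl = zero , inj₂ refl , λ
  { zero _ → refl ; (suc i) e → ⊥-elim (degree≡0⇒¬ends H (inj₂ y) (suc-injective eq) i e) }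
... | no b≢y with degree≡1⇒unique-end H (inj₂ y) eq
...   | j , ej , only-j = suc j , ej , λ
  { zero (inj₂ refl) → ⊥-elim (b≢y refl) ; (suc i) e → cong suc (only-j i e) }

_≟ᵥ_ : ∀ {m} (u w : Vertex m) → Dec (u ≡ w)
_≟ᵥ_ = Sum.≡-dec _≟_ _≟_

anyVertex? : ∀ {m} {P : Vertex m → Set} → (∀ v → Dec (P v)) → Dec (∃ P)
anyVertex? P? with any? (P? ∘ inj₁) | any? (P? ∘ inj₂)
... | yes (a , p) | _           = yes (inj₁ a , p)
... | no _        | yes (b , p) = yes (inj₂ b , p)
... | no ¬l       | no ¬r       = no λ { (inj₁ a , p) → ¬l (a , p) ; (inj₂ b , p) → ¬r (b , p) }

allVertex? : ∀ {m} {P : Vertex m → Set} → (∀ v → Dec (P v)) → Dec (∀ v → P v)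
allVertex? P? with all? (P? ∘ inj₁) | all? (P? ∘ inj₂)
... | yes l | yes r = yes λ { (inj₁ a) → l a ; (inj₂ b) → r b }
... | no ¬l | _     = no λ all → ¬l (all ∘ inj₁)
... | yes _ | no ¬r = no λ all → ¬r (all ∘ inj₂)

unique-++-∷ : ∀ {A : Set} (p : List A) {j q} → Unique (p ++ j ∷ q) → All (_≢ j) p × All (_≢ j) q
unique-++-∷ []      (j∉q ∷ _) = [] , All.map ≢-sym j∉q
unique-++-∷ (x ∷ p) (x∉ ∷ u)  =
  All.lookup x∉ (List.∈-++⁺ʳ p (here refl)) ∷ proj₁ (unique-++-∷ p u) , proj₂ (unique-++-∷ p u)

-- Walks, cycles and components in subgraphs given by edge predicates

module Subgraphs {m : ℕ} (G : Graph m) where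

  Edge : Set
  Edge = Fin (length G)

  endsOf : Edge → Fin m × Fin m
  endsOf = lookup G

  left right : Edge → Vertex m
  left  i = inj₁ (proj₁ (endsOf i))
  right i = inj₂ (proj₂ (endsOf i))

  ConnectedIn : (Edge → Set) → Vertex m → Vertex m → Set
  ConnectedIn Q u w = Σ (List Edge) λ is → Walk G u w is × All Q is

  HasCycleIn : (Edge → Set) → Set
  HasCycleIn Q = Σ (Vertex m) λ v → Σ (List Edge) λ is →
    (is ≢ []) × Unique is × Walk G v v is × All Q is

  _∖_ : (Edge → Set) → Edge → Edge → Set
  (Q ∖ j) i = Q i × i ≢ j

  walk-++ : ∀ {u v w p q} → Walk G u v p → Walk G v w q → Walk G u w (p ++ q)
  walk-++ []           b = b
  walk-++ (step i j a) b = step i j (walk-++ a b)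

  walk-split : ∀ {u w} p {q} → Walk G u w (p ++ q) → ∃ λ v → Walk G u v p × Walk G v w q
  walk-split []      a = _ , [] , a
  walk-split (i ∷ p) (step .i j a) =
    let v , b , c = walk-split p a in v , step i j b , c

  module _ {Q : Edge → Set} where

    connected-refl : ∀ {u} → ConnectedIn Q u u
    connected-refl = [] , [] , []

    connected-trans : ∀ {u v w} → ConnectedIn Q u v → ConnectedIn Q v w → ConnectedIn Q u w
    connected-trans (p , a , qp) (q , b , qq) = p ++ q , walk-++ a b , All.++⁺ qp qq

    connected-edge : ∀ {u w} i → Q i → Joins (endsOf i) u w → ConnectedIn Q u w
    connected-edge i qi j = i ∷ [] , step i j [] , qi ∷ []

    connected-sym : ∀ {u w} → ConnectedIn Q u w → ConnectedIn Q w u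
    connected-sym (.[] , [] , []) = connected-refl
    connected-sym (.(i ∷ _) , step i j a , qi ∷ qs) =
      connected-trans (connected-sym (_ , a , qs)) (connected-edge i qi (joins-sym j))

    connected-ends : ∀ i → Q i → ∀ {p q} → Ends (endsOf i) p → Ends (endsOf i) q → ConnectedIn Q p q
    connected-ends i qi (inj₁ refl) (inj₁ refl) = connected-refl
    connected-ends i qi (inj₁ refl) (inj₂ refl) = connected-edge i qi (inj₁ (refl , refl))
    connected-ends i qi (inj₂ refl) (inj₁ refl) = connected-edge i qi (inj₂ (refl , refl))
    connected-ends i qi (inj₂ refl) (inj₂ refl) = connected-refl

  module _ {Q Q′ : Edge → Set} (Q⊆Q′ : ∀ i → Q i → Q′ i) where

    connected-mono : ∀ {u w} → ConnectedIn Q u w → ConnectedIn Q′ u w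
    connected-mono (is , a , qs) = is , a , All.map (Q⊆Q′ _) qs

    hasCycle-mono : HasCycleIn Q → HasCycleIn Q′
    hasCycle-mono (v , is , ne , u , a , qs) = v , is , ne , u , a , All.map (Q⊆Q′ _) qs

  -- Cut a Q-walk at its first and last use of j.
  walk-avoids-or-meets : ∀ {Q : Edge → Set} (j : Edge) {u w is} → Walk G u w is → All Q is →
    All (Q ∖ j) is ⊎
    ((∃ λ p → Ends (endsOf j) p × ConnectedIn (Q ∖ j) u p) ×
     (∃ λ q → Ends (endsOf j) q × ConnectedIn (Q ∖ j) q w))
  walk-avoids-or-meets j [] [] = inj₁ []
  walk-avoids-or-meets j (step i i-u-v a) (qi ∷ qs) with i ≟ j | walk-avoids-or-meets j a qs
  ... | yes refl | inj₁ avoids =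
    inj₂ ((_ , joins⇒endsˡ i-u-v , connected-refl) , (_ , joins⇒endsʳ i-u-v , (_ , a , avoids)))
  ... | yes refl | inj₂ (_ , after) = inj₂ ((_ , joins⇒endsˡ i-u-v , connected-refl) , after)
  ... | no i≢j   | inj₁ avoids = inj₁ ((qi , i≢j) ∷ avoids)
  ... | no i≢j   | inj₂ ((p , ep , (ps , pw , pq)) , after) =
    inj₂ ((p , ep , (i ∷ ps , step i i-u-v pw , (qi , i≢j) ∷ pq)) , after)

  isolated-walk : ∀ {Z : Edge → Set} {x} → (∀ i → Z i → ¬ Ends (endsOf i) x) →
    ∀ {u w is} → Walk G u w is → All Z is → u ≡ x ⊎ w ≡ x → u ≡ w
  isolated-walk x-isolated [] _ _ = refl
  isolated-walk x-isolated (step i i-u-v a) (zi ∷ _) (inj₁ refl) =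
    ⊥-elim (x-isolated i zi (joins⇒endsˡ i-u-v))
  isolated-walk x-isolated (step i i-u-v a) (zi ∷ zs) (inj₂ refl) =
    ⊥-elim (x-isolated i zi (subst (Ends (endsOf i)) (isolated-walk x-isolated a zs (inj₂ refl))
                                                    (joins⇒endsʳ i-u-v)))

  walk? : (u w : Vertex m) (is : List Edge) → Dec (Walk G u w is)
  walk? u w [] with u ≟ᵥ w
  ... | yes refl = yes []
  ... | no u≢w   = no λ { [] → u≢w refl }
  walk? u w (i ∷ is) with u ≟ᵥ left i
  ... | yes refl = Dec.map′ (step i (inj₁ (refl , refl))) tail (walk? (right i) w is)
    where
    tail : Walk G (left i) w (i ∷ is) → Walk G (right i) w is
    tail (step _ (inj₁ (_ , refl)) a) = a
  ... | no u≢l with u ≟ᵥ right i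
  ...   | yes refl = Dec.map′ (step i (inj₂ (refl , refl))) tail (walk? (left i) w is)
    where
    tail : Walk G (right i) w (i ∷ is) → Walk G (left i) w is
    tail (step _ (inj₂ (_ , refl)) a) = a
  ...   | no u≢r = no λ { (step _ (inj₁ (u≡l , _)) _) → u≢l u≡l
                        ; (step _ (inj₂ (u≡r , _)) _) → u≢r u≡r }

  hasCycleIn? : {Q : Edge → Set} → (∀ i → Dec (Q i)) → Dec (HasCycleIn Q)
  hasCycleIn? Q? = Dec.map′
    (λ (v , is , _ , c) → v , is , c)
    (λ (v , is , ne , u , c) → v , is , unique⇒length≤ u , ne , u , c)
    (anyVertex? λ v → any-list≤? (length G) λ is →
      nonEmpty? is ×-dec unique? is ×-dec walk? v v is ×-dec All.all? Q? is)
    where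
    open import Data.List.Relation.Unary.Unique.DecPropositional _≟_ using (unique?)
    nonEmpty? : (is : List Edge) → Dec (is ≢ [])
    nonEmpty? []      = no λ ne → ne refl
    nonEmpty? (_ ∷ _) = yes λ ()

  private
    ConnectedAmong : List Edge → Vertex m → Vertex m → Set
    ConnectedAmong ks = ConnectedIn (List._∈ ks)

    Reaches : List Edge → Edge → Vertex m → Set
    Reaches ks k u = ConnectedAmong ks u (left k) ⊎ ConnectedAmong ks u (right k)

    ConnectedAmong[]⇔≡ : ∀ {u w} → ConnectedAmong [] u w ⇔ u ≡ w
    ConnectedAmong[]⇔≡ = mk⇔ (λ { (_ , [] , []) → refl }) (λ { refl → connected-refl })

    -- A walk using a new edge k passes through both of its ends.
    ConnectedAmong-∷⇔ : ∀ {ks k u w} →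
      ConnectedAmong (k ∷ ks) u w ⇔ (ConnectedAmong ks u w ⊎ (Reaches ks k u × Reaches ks k w))
    ConnectedAmong-∷⇔ {ks} {k} {u} {w} = mk⇔ to from
      where
      old : ∀ i → (List._∈ k ∷ ks) i × i ≢ k → i List.∈ ks
      old i (here refl , i≢k) = ⊥-elim (i≢k refl)
      old i (there i∈ , _)    = i∈
      reaches : ∀ {x p} → Ends (endsOf k) p → ConnectedAmong ks x p → Reaches ks k x
      reaches (inj₁ refl) c = inj₁ c
      reaches (inj₂ refl) c = inj₂ c
      via-k : ∀ {x y} → Reaches ks k x → Reaches ks k y → ConnectedAmong (k ∷ ks) x y
      via-k rx ry = connected-trans (end rx) (connected-sym (end ry))
        where
        k-ends : ∀ {p q} → Ends (endsOf k) p → Ends (endsOf k) q → ConnectedAmong (k ∷ ks) p q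
        k-ends = connected-ends k (here refl)
        end : ∀ {x} → Reaches ks k x → ConnectedAmong (k ∷ ks) x (left k)
        end (inj₁ c) = connected-mono (λ _ → there) c
        end (inj₂ c) = connected-trans (connected-mono (λ _ → there) c) (k-ends (inj₂ refl) (inj₁ refl))
      to : ConnectedAmong (k ∷ ks) u w → ConnectedAmong ks u w ⊎ (Reaches ks k u × Reaches ks k w)
      to (is , a , al) with walk-avoids-or-meets k a al
      ... | inj₁ avoids = inj₁ (is , a , All.map (old _) avoids)
      ... | inj₂ ((p , ep , cp) , (q , eq , cq)) =
        inj₂ (reaches ep (connected-mono old cp) , reaches eq (connected-mono old (connected-sym cq)))
      from : ConnectedAmong ks u w ⊎ (Reaches ks k u × Reaches ks k w) → ConnectedAmong (k ∷ ks) u w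
      from (inj₁ c)         = connected-mono (λ _ → there) c
      from (inj₂ (ru , rw)) = via-k ru rw

    connectedAmong? : ∀ ks u w → Dec (ConnectedAmong ks u w)
    connectedAmong? [] u w = Dec.map (⇔.sym ConnectedAmong[]⇔≡) (u ≟ᵥ w)
    connectedAmong? (k ∷ ks) u w = Dec.map (⇔.sym ConnectedAmong-∷⇔)
      (connectedAmong? ks u w ⊎-dec (reaches? u ×-dec reaches? w))
      where
      reaches? : ∀ x → Dec (Reaches ks k x)
      reaches? x = connectedAmong? ks x (left k) ⊎-dec connectedAmong? ks x (right k)

  connectedIn? : {Q : Edge → Set} → (∀ i → Dec (Q i)) → ∀ u w → Dec (ConnectedIn Q u w)
  connectedIn? Q? u w = Dec.map′
    (connected-mono λ _ i∈ → proj₂ (List.∈-filter⁻ Q? {xs = allFin _} i∈))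
    (connected-mono λ i qi → List.∈-filter⁺ Q? (List.∈-allFin i) qi)
    (connectedAmong? (filter Q? (allFin _)) u w)

  AtMostUnicyclic : (Edge → Set) → Set
  AtMostUnicyclic Q = ¬ HasCycleIn Q ⊎ ∃ λ i → ¬ HasCycleIn (Q ∖ i)

  ComponentOf : (Edge → Set) → Vertex m → Edge → Set
  ComponentOf Q v i = Q i × ConnectedIn Q v (left i)

  AtMostUnicyclicComponents : (Edge → Set) → Set
  AtMostUnicyclicComponents Q = ∀ v → AtMostUnicyclic (ComponentOf Q v)

  removal≤1⇒atMostUnicyclic : ∀ (Z L : Subset (length G)) → ∣ L ∣ ≤ 1 → ¬ HasCycleIn (_∈ Z ─ L) →
    AtMostUnicyclic (_∈ Z)
  removal≤1⇒atMostUnicyclic Z L ∣L∣≤1 acyclic with nonempty? L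
  ... | no ∄ = inj₁ (acyclic ∘ hasCycle-mono λ i i∈Z → x∈p∧x∉q⇒x∈p─q i∈Z (λ i∈L → ∄ (i , i∈L)))
  ... | yes (r , r∈L) = inj₂ (r , acyclic ∘ hasCycle-mono λ i (i∈Z , i≢r) →
    x∈p∧x∉q⇒x∈p─q i∈Z (λ i∈L → i≢r (∣p∣≤1⇒subsingleton L ∣L∣≤1 i∈L r∈L)))

  atMostUnicyclic-anti : ∀ {Q Q′ : Edge → Set} → (∀ i → Q i → Q′ i) →
    AtMostUnicyclic Q′ → AtMostUnicyclic Q
  atMostUnicyclic-anti Q⊆Q′ (inj₁ acyclic)      = inj₁ (acyclic ∘ hasCycle-mono Q⊆Q′)
  atMostUnicyclic-anti Q⊆Q′ (inj₂ (i , acyclic)) =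
    inj₂ (i , acyclic ∘ hasCycle-mono λ k (qk , k≢i) → Q⊆Q′ k qk , k≢i)

  atMostUnicyclicComponents-cong : ∀ {Q Q′ : Edge → Set} → (∀ i → Q i ⇔ Q′ i) →
    AtMostUnicyclicComponents Q → AtMostUnicyclicComponents Q′
  atMostUnicyclicComponents-cong {Q} {Q′} Q⇔Q′ amuc v = atMostUnicyclic-anti
    (λ i (q′i , c) → from i q′i , connected-mono from c)
    (amuc v)
    where
    from : ∀ i → Q′ i → Q i
    from i = Equivalence.from (Q⇔Q′ i)

  atMostUnicyclicComponents? : {Q : Edge → Set} → (∀ i → Dec (Q i)) →
    Dec (AtMostUnicyclicComponents Q)
  atMostUnicyclicComponents? Q? =
    allVertex? λ v → atMostUnicyclic? (λ k → Q? k ×-dec connectedIn? Q? v (left k))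
    where
    atMostUnicyclic? : {Q : Edge → Set} → (∀ i → Dec (Q i)) → Dec (AtMostUnicyclic Q)
    atMostUnicyclic? Q? =
      ¬? (hasCycleIn? Q?) ⊎-dec any? (λ i → ¬? (hasCycleIn? λ k → Q? k ×-dec ¬? (k ≟ i)))

  -- Components not containing j are untouched by deleting j.
  atMostUnicyclicComponents-restore : ∀ {Q : Edge → Set} → (∀ i → Dec (Q i)) → ∀ {j} → Q j →
    AtMostUnicyclicComponents (Q ∖ j) → AtMostUnicyclic (ComponentOf Q (left j)) →
    AtMostUnicyclicComponents Q
  atMostUnicyclicComponents-restore {Q} Q? {j} qj amuc amu-j v with connectedIn? Q? v (left j)
  ... | yes v~j = atMostUnicyclic-anti
    (λ k (qk , c) → qk , connected-trans (connected-sym v~j) c) amu-j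
  ... | no v≁j = atMostUnicyclic-anti avoid (amuc v)
    where
    avoid : ∀ k → ComponentOf Q v k → ComponentOf (Q ∖ j) v k
    avoid k (qk , (is , a , qs)) with walk-avoids-or-meets j a qs
    ... | inj₁ avoids = (qk , λ { refl → v≁j (is , a , qs) }) , (is , a , avoids)
    ... | inj₂ ((p , ep , v~p) , _) = ⊥-elim (v≁j (connected-trans
      (connected-mono (λ _ → proj₁) v~p) (connected-ends j qj ep (inj₁ refl))))

  module _ {Y : Edge → Set} {j : Edge} {x y : Vertex m} (j-x-y : Joins (endsOf j) x y)
           (x-leaf : ∀ i → Y i → Ends (endsOf i) x → i ≡ j) where

    private
      x-isolated : ∀ i → (Y ∖ j) i → ¬ Ends (endsOf i) x
      x-isolated i (yi , i≢j) = i≢j ∘ x-leaf i yi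

      -- Rotating a cycle through j yields a walk between the ends of j avoiding j, which x cannot have.
      cycle-avoids-leaf : ∀ {Z} → (∀ i → Z i → Y i) → HasCycleIn Z → HasCycleIn (Z ∖ j)
      cycle-avoids-leaf {Z} Z⊆Y (v , is , ne , u , v-v , zs) with Any.any? (j ≟_) is
      ... | no j∉is = v , is , ne , u , v-v ,
        All.zipWith (λ (zi , i≢j) → zi , i≢j) (zs , All.map ≢-sym (All.¬Any⇒All¬ is j∉is))
      ... | yes j∈is with List.∈-∃++ j∈is
      ...   | p , q , refl with walk-split p v-v
      ...     | a , v-a , step {w = b} .j j-a-b b-v =
        ⊥-elim (joins-irrefl j-a-b (sym (isolated-walk x-isolated (walk-++ b-v v-a)
                                                        (All.++⁺ avoid-q avoid-p) x-end)))
        where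
        avoid-p : All (Y ∖ j) p
        avoid-p = All.zipWith (λ (zi , i≢j) → Z⊆Y _ zi , i≢j)
                              (All.++⁻ˡ p zs , proj₁ (unique-++-∷ p u))
        avoid-q : All (Y ∖ j) q
        avoid-q = All.zipWith (λ (zi , i≢j) → Z⊆Y _ zi , i≢j)
                              (All.tail (All.++⁻ʳ p zs) , proj₂ (unique-++-∷ p u))
        x-end : b ≡ x ⊎ a ≡ x
        x-end = [ inj₂ ∘ sym , inj₁ ∘ sym ]′ (ends-of-joins j-a-b (joins⇒endsˡ j-x-y))

      from-end-of-j : ∀ {i p} → Y i → i ≢ j → Ends (endsOf j) p → ConnectedIn (Y ∖ j) p (left i) →
                      ConnectedIn (Y ∖ j) y (left i)
      from-end-of-j {i} {p} yi i≢j ep (is , a , ys) with ends-of-joins j-x-y ep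
      ... | inj₁ p≡x =
        ⊥-elim (i≢j (x-leaf i yi (inj₁ (trans (sym p≡x) (isolated-walk x-isolated a ys (inj₁ p≡x))))))
      ... | inj₂ p≡y = subst (λ z → ConnectedIn (Y ∖ j) z (left i)) p≡y (is , a , ys)

      beyond-leaf : ∀ i → (ComponentOf Y (left j) ∖ j) i → ComponentOf (Y ∖ j) y i
      beyond-leaf i ((yi , (is , a , ys)) , i≢j) with walk-avoids-or-meets j a ys
      ... | inj₁ avoids = (yi , i≢j) , from-end-of-j yi i≢j (inj₁ refl) (is , a , avoids)
      ... | inj₂ (_ , (q , eq , q~i)) = (yi , i≢j) , from-end-of-j yi i≢j eq q~i

    leaf-component-atMostUnicyclic : AtMostUnicyclicComponents (Y ∖ j) →
      AtMostUnicyclic (ComponentOf Y (left j))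
    leaf-component-atMostUnicyclic amuc with amuc y
    ... | inj₁ acyclic = inj₁ (acyclic ∘ hasCycle-mono beyond-leaf ∘ cycle-avoids-leaf (λ _ → proj₁))
    ... | inj₂ (i , acyclic) =
      inj₂ (i , acyclic ∘ hasCycle-mono beyond-leaf∖i ∘ cycle-avoids-leaf (λ _ → proj₁ ∘ proj₁))
      where
      beyond-leaf∖i : ∀ k → ((ComponentOf Y (left j) ∖ i) ∖ j) k → (ComponentOf (Y ∖ j) y ∖ i) k
      beyond-leaf∖i k ((c , k≢i) , k≢j) = beyond-leaf k (c , k≢j) , k≢i

-- Restriction to an edge set

module _ {m : ℕ} where

  embed : (G : Graph m) (X : Subset (length G)) → Fin (length (restrict G X)) → Fin (length G)
  embed []      []          ()
  embed (e ∷ G) (true  ∷ X) zero    = zero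
  embed (e ∷ G) (true  ∷ X) (suc j) = suc (embed G X j)
  embed (e ∷ G) (false ∷ X) j       = suc (embed G X j)

  lookup-restrict : ∀ (G : Graph m) X j → lookup (restrict G X) j ≡ lookup G (embed G X j)
  lookup-restrict []      []          ()
  lookup-restrict (e ∷ G) (true  ∷ X) zero    = refl
  lookup-restrict (e ∷ G) (true  ∷ X) (suc j) = lookup-restrict G X j
  lookup-restrict (e ∷ G) (false ∷ X) j       = lookup-restrict G X j

  embed-∈ : ∀ (G : Graph m) X j → embed G X j ∈ X
  embed-∈ []      []          ()
  embed-∈ (e ∷ G) (true  ∷ X) zero    = here
  embed-∈ (e ∷ G) (true  ∷ X) (suc j) = there (embed-∈ G X j)
  embed-∈ (e ∷ G) (false ∷ X) j       = there (embed-∈ G X j)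

  embed-injective : ∀ (G : Graph m) X {j k} → embed G X j ≡ embed G X k → j ≡ k
  embed-injective []      []          {()}
  embed-injective (e ∷ G) (true  ∷ X) {zero}  {zero}  _  = refl
  embed-injective (e ∷ G) (true  ∷ X) {suc j} {suc k} eq =
    cong suc (embed-injective G X (Fin.suc-injective eq))
  embed-injective (e ∷ G) (false ∷ X)                 eq = embed-injective G X (Fin.suc-injective eq)

  embed-surjective : ∀ (G : Graph m) X {i} → i ∈ X → ∃ λ j → embed G X j ≡ i
  embed-surjective (e ∷ G) (true  ∷ X) here      = zero , refl
  embed-surjective (e ∷ G) (true  ∷ X) (there i∈) with embed-surjective G X i∈
  ... | j , refl = suc j , refl
  embed-surjective (e ∷ G) (false ∷ X) (there i∈) with embed-surjective G X i∈
  ... | j , refl = j , refl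

  lift : (G : Graph m) (X : Subset (length G)) → Subset (length (restrict G X)) → Subset (length G)
  lift []      []          []      = []
  lift (e ∷ G) (true  ∷ X) (b ∷ B) = b ∷ lift G X B
  lift (e ∷ G) (false ∷ X) B       = false ∷ lift G X B

  restrict-restrict : ∀ (G : Graph m) X B → restrict (restrict G X) B ≡ restrict G (lift G X B)
  restrict-restrict []      []          []          = refl
  restrict-restrict (e ∷ G) (true  ∷ X) (true  ∷ B) = cong (e ∷_) (restrict-restrict G X B)
  restrict-restrict (e ∷ G) (true  ∷ X) (false ∷ B) = restrict-restrict G X B
  restrict-restrict (e ∷ G) (false ∷ X) B           = restrict-restrict G X B

  embed-∈-lift : ∀ (G : Graph m) X B {j} → j ∈ B → embed G X j ∈ lift G X B
  embed-∈-lift []      []          []      {()}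
  embed-∈-lift (e ∷ G) (true  ∷ X) (b ∷ B) {zero}  here      = here
  embed-∈-lift (e ∷ G) (true  ∷ X) (b ∷ B) {suc j} (there j∈) = there (embed-∈-lift G X B j∈)
  embed-∈-lift (e ∷ G) (false ∷ X) B                j∈        = there (embed-∈-lift G X B j∈)

  ∈-lift⁻ : ∀ (G : Graph m) X B {i} → i ∈ lift G X B → ∃ λ j → embed G X j ≡ i × j ∈ B
  ∈-lift⁻ (e ∷ G) (true  ∷ X) (b ∷ B) here       = zero , refl , here
  ∈-lift⁻ (e ∷ G) (true  ∷ X) (b ∷ B) (there i∈) with ∈-lift⁻ G X B i∈
  ... | j , refl , j∈ = suc j , refl , there j∈
  ∈-lift⁻ (e ∷ G) (false ∷ X) B       (there i∈) with ∈-lift⁻ G X B i∈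
  ... | j , refl , j∈ = j , refl , j∈

  lift⊆ : ∀ (G : Graph m) X B → lift G X B ⊆ X
  lift⊆ G X B i∈ with ∈-lift⁻ G X B i∈
  ... | j , refl , _ = embed-∈ G X j

  ∣lift∣≡∣∣ : ∀ (G : Graph m) X B → ∣ lift G X B ∣ ≡ ∣ B ∣
  ∣lift∣≡∣∣ []      []          []          = refl
  ∣lift∣≡∣∣ (e ∷ G) (true  ∷ X) (true  ∷ B) = cong suc (∣lift∣≡∣∣ G X B)
  ∣lift∣≡∣∣ (e ∷ G) (true  ∷ X) (false ∷ B) = ∣lift∣≡∣∣ G X B
  ∣lift∣≡∣∣ (e ∷ G) (false ∷ X) B           = ∣lift∣≡∣∣ G X B

  project : (G : Graph m) (X : Subset (length G)) → Subset (length G) → Subset (length (restrict G X))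
  project []      []          []      = []
  project (e ∷ G) (true  ∷ X) (b ∷ R) = b ∷ project G X R
  project (e ∷ G) (false ∷ X) (b ∷ R) = project G X R

  lift-project : ∀ (G : Graph m) X R → R ⊆ X → lift G X (project G X R) ≡ R
  lift-project []      []          []            _   = refl
  lift-project (e ∷ G) (true  ∷ X) (b     ∷ R) R⊆X = cong (b ∷_) (lift-project G X R (drop-∷-⊆ R⊆X))
  lift-project (e ∷ G) (false ∷ X) (true  ∷ R) R⊆X with () ← R⊆X here
  lift-project (e ∷ G) (false ∷ X) (false ∷ R) R⊆X =
    cong (false ∷_) (lift-project G X R (drop-∷-⊆ R⊆X))

  ∈-lift-∁⇔ : ∀ (G : Graph m) X B {i} → i ∈ lift G X (∁ B) ⇔ i ∈ X ─ lift G X B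
  ∈-lift-∁⇔ G X B = mk⇔ to from
    where
    to : ∀ {i} → i ∈ lift G X (∁ B) → i ∈ X ─ lift G X B
    to i∈ with ∈-lift⁻ G X (∁ B) i∈
    ... | j , refl , j∈∁B = x∈p∧x∉q⇒x∈p─q (embed-∈ G X j) λ i∈B →
      let k , k≡j , k∈B = ∈-lift⁻ G X B i∈B
      in x∈∁p⇒x∉p j∈∁B (subst (_∈ B) (embed-injective G X k≡j) k∈B)
    from : ∀ {i} → i ∈ X ─ lift G X B → i ∈ lift G X (∁ B)
    from i∈ with Equivalence.to ∈─⇔ i∈
    ... | i∈X , i∉B with embed-surjective G X i∈X
    ...   | j , refl = embed-∈-lift G X (∁ B) (x∉p⇒x∈∁p (i∉B ∘ embed-∈-lift G X B))

module Restriction {m : ℕ} (G : Graph m) (X : Subset (length G)) where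
  open Subgraphs G

  private
    H : Graph m
    H = restrict G X

    walk-embed : ∀ {u w js} → Walk H u w js →
      Walk G u w (map (embed G X) js) × All (_∈ X) (map (embed G X) js)
    walk-embed [] = [] , []
    walk-embed (step j j-u-v a) =
      let b , b∈X = walk-embed a
      in step (embed G X j) (subst (λ e → Joins e _ _) (lookup-restrict G X j) j-u-v) b , embed-∈ G X j ∷ b∈X

    walk-unembed : ∀ {u w is} → Walk G u w is → All (_∈ X) is →
      ∃ λ js → map (embed G X) js ≡ is × Walk H u w js
    walk-unembed [] [] = [] , refl , []
    walk-unembed (step i i-u-v a) (i∈X ∷ is∈X) with embed-surjective G X i∈X | walk-unembed a is∈X
    ... | j , refl | js , refl , b =
      j ∷ js , refl , step j (subst (λ e → Joins e _ _) (sym (lookup-restrict G X j)) i-u-v) b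

  hasCycle-restrict⇔ : HasCycle (restrict G X) ⇔ HasCycleIn (_∈ X)
  hasCycle-restrict⇔ = mk⇔ to from
    where
    map-nonEmpty : ∀ js → js ≢ [] → map (embed G X) js ≢ []
    map-nonEmpty []      ne = ⊥-elim (ne refl)
    map-nonEmpty (_ ∷ _) _  = λ ()
    to : HasCycle H → HasCycleIn (_∈ X)
    to (v , js , ne , u , a) =
      v , map (embed G X) js , map-nonEmpty js ne , UniqueP.map⁺ (embed-injective G X) u , walk-embed a
    from : HasCycleIn (_∈ X) → HasCycle H
    from (v , is , ne , u , a , is∈X) with walk-unembed a is∈X
    ... | js , refl , b = v , js , (λ { refl → ne refl }) , UniqueP.map⁻ u , b

  connected-restrict⇔ : ∀ {u w} → Connected (restrict G X) u w ⇔ ConnectedIn (_∈ X) u w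
  connected-restrict⇔ = mk⇔
    (λ (js , a) → _ , walk-embed a)
    (λ (is , a , is∈X) → let js , _ , b = walk-unembed a is∈X in js , b)

-- Cyclomatic number and excess in terms of edge predicates

hasCycle? : ∀ {m} (H : Graph m) → Dec (HasCycle H)
hasCycle? H = Dec.map′
  (λ (v , is , ne , u , a , _) → v , is , ne , u , a)
  (λ (v , is , ne , u , a) → v , is , ne , u , a , All.universal _ is)
  (Subgraphs.hasCycleIn? H λ _ → yes tt)

connected? : ∀ {m} (H : Graph m) u w → Dec (Connected H u w)
connected? H u w = Dec.map′
  (λ (is , a , _) → is , a)
  (λ (is , a) → is , a , All.universal _ is)
  (Subgraphs.connectedIn? H (λ _ → yes tt) u w)

cyclomaticNumber-exists : ∀ {m} (H : Graph m) → ∃ (IsCyclomaticNumber H)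
cyclomaticNumber-exists H =
  least-cardinality (λ R → ¬? (hasCycle? (restrict H (∁ R)))) ⊤ (acyclic-without-all H)
  where
  acyclic-without-all : ∀ {m} (H : Graph m) → Acyclic (restrict H (∁ ⊤))
  acyclic-without-all []      (_ , []     , ne , _) = ne refl
  acyclic-without-all (e ∷ H) c                     = acyclic-without-all H c

Cyclomatic≤1 : ∀ {m} → Graph m → Set
Cyclomatic≤1 H = ∃[ k ] (IsCyclomaticNumber H k × k ≤ 1)

module Characterisation {m : ℕ} (G : Graph m) where
  open Subgraphs G

  hasCycle-restrict²⇔ : ∀ X B →
    HasCycle (restrict (restrict G X) (∁ B)) ⇔ HasCycleIn (_∈ X ─ lift G X B)
  hasCycle-restrict²⇔ X B = mk⇔
    (hasCycle-mono (λ _ → Equivalence.to (∈-lift-∁⇔ G X B)) ∘ Equivalence.to hasCycle-restrict⇔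
      ∘ subst HasCycle (restrict-restrict G X (∁ B)))
    (subst HasCycle (sym (restrict-restrict G X (∁ B))) ∘ Equivalence.from hasCycle-restrict⇔
      ∘ hasCycle-mono (λ _ → Equivalence.from (∈-lift-∁⇔ G X B)))
    where open Restriction G (lift G X (∁ B))

  cyclomatic≤1⇔atMostUnicyclic : ∀ Z → Cyclomatic≤1 (restrict G Z) ⇔ AtMostUnicyclic (_∈ Z)
  cyclomatic≤1⇔atMostUnicyclic Z = mk⇔ to from
    where
    to : Cyclomatic≤1 (restrict G Z) → AtMostUnicyclic (_∈ Z)
    to (k , ((R , ∣R∣≡k , acyclic) , _) , k≤1) = removal≤1⇒atMostUnicyclic Z (lift G Z R)
      (subst (_≤ 1) (sym (trans (∣lift∣≡∣∣ G Z R) ∣R∣≡k)) k≤1)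
      (acyclic ∘ Equivalence.from (hasCycle-restrict²⇔ Z R))
    from : AtMostUnicyclic (_∈ Z) → Cyclomatic≤1 (restrict G Z)
    from amu with cyclomaticNumber-exists (restrict G Z)
    ... | k , cn = k , cn , bound amu
      where
      removal-bound : ∀ B → ¬ HasCycleIn (_∈ Z ─ lift G Z B) → k ≤ ∣ B ∣
      removal-bound B acyclic = proj₂ cn B (acyclic ∘ Equivalence.to (hasCycle-restrict²⇔ Z B))
      bound-⊥ : ¬ HasCycleIn (_∈ Z) → k ≤ 1
      bound-⊥ acyclic = ≤-trans (removal-bound ⊥ (acyclic ∘ hasCycle-mono λ _ → p─q⊆p Z _))
                                (≤-trans (≤-reflexive (∣⊥∣≡0 (length (restrict G Z)))) z≤n)
      bound : AtMostUnicyclic (_∈ Z) → k ≤ 1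
      bound (inj₁ acyclic) = bound-⊥ acyclic
      bound (inj₂ (i₀ , acyclic)) with i₀ ∈? Z
      ... | no i₀∉Z = bound-⊥ (acyclic ∘ hasCycle-mono λ i i∈Z → i∈Z , λ { refl → i₀∉Z i∈Z })
      ... | yes i₀∈Z with embed-surjective G Z i₀∈Z
      ...   | j₀ , refl =
        ≤-trans (removal-bound ⁅ j₀ ⁆ (acyclic ∘ hasCycle-mono avoid-j₀)) (≤-reflexive (∣⁅x⁆∣≡1 j₀))
        where
        avoid-j₀ : ∀ i → i ∈ Z ─ lift G Z ⁅ j₀ ⁆ → i ∈ Z × i ≢ embed G Z j₀
        avoid-j₀ i i∈ with Equivalence.to ∈─⇔ i∈
        ... | i∈Z , i∉L = i∈Z , λ { refl → i∉L (embed-∈-lift G Z ⁅ j₀ ⁆ (x∈⁅x⁆ j₀)) }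

  ∈-lift-component⇔ : ∀ Y {v C} → IsComponent (restrict G Y) v C →
    ∀ {i} → i ∈ lift G Y C ⇔ ComponentOf (_∈ Y) v i
  ∈-lift-component⇔ Y {v} {C} component = mk⇔ to from
    where
    open Restriction G Y
    left≡ : ∀ j → inj₁ (proj₁ (lookup (restrict G Y) j)) ≡ left (embed G Y j)
    left≡ j = cong (inj₁ ∘ proj₁) (lookup-restrict G Y j)
    to : ∀ {i} → i ∈ lift G Y C → ComponentOf (_∈ Y) v i
    to i∈ with ∈-lift⁻ G Y C i∈
    ... | j , refl , j∈C = embed-∈ G Y j ,
      subst (ConnectedIn (_∈ Y) v) (left≡ j)
        (Equivalence.to connected-restrict⇔ (Equivalence.to (component j) j∈C))
    from : ∀ {i} → ComponentOf (_∈ Y) v i → i ∈ lift G Y C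
    from (i∈Y , v~i) with embed-surjective G Y i∈Y
    ... | j , refl = embed-∈-lift G Y C (Equivalence.from (component j)
      (Equivalence.from connected-restrict⇔ (subst (ConnectedIn (_∈ Y) v) (sym (left≡ j)) v~i)))

  acyclicOrUnicyclicComponents⇔ : ∀ Y →
    AcyclicOrUnicyclicComponents (restrict G Y) ⇔ AtMostUnicyclicComponents (_∈ Y)
  acyclicOrUnicyclicComponents⇔ Y = mk⇔ to from
    where
    to : AcyclicOrUnicyclicComponents (restrict G Y) → AtMostUnicyclicComponents (_∈ Y)
    to aouc v = atMostUnicyclic-anti (λ _ → Equivalence.from (∈-lift-component⇔ Y component))
      (Equivalence.to (cyclomatic≤1⇔atMostUnicyclic (lift G Y C))
        (subst Cyclomatic≤1 (restrict-restrict G Y C) (aouc v C component)))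
      where
      C : Subset (length (restrict G Y))
      C = subsetOf λ j → connected? (restrict G Y) v (inj₁ (proj₁ (lookup (restrict G Y) j)))
      component : IsComponent (restrict G Y) v C
      component j = ∈-subsetOf _
    from : AtMostUnicyclicComponents (_∈ Y) → AcyclicOrUnicyclicComponents (restrict G Y)
    from amuc v C component = subst Cyclomatic≤1 (sym (restrict-restrict G Y C))
      (Equivalence.from (cyclomatic≤1⇔atMostUnicyclic (lift G Y C))
        (atMostUnicyclic-anti (λ _ → Equivalence.to (∈-lift-component⇔ Y component)) (amuc v)))

  acyclicOrUnicyclicComponents-restrict²⇔ : ∀ X B →
    AcyclicOrUnicyclicComponents (restrict (restrict G X) (∁ B)) ⇔
    AtMostUnicyclicComponents (_∈ X ─ lift G X B)
  acyclicOrUnicyclicComponents-restrict²⇔ X B = mk⇔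
    (atMostUnicyclicComponents-cong (λ _ → ∈-lift-∁⇔ G X B) ∘ Equivalence.to Y⇔
      ∘ subst AcyclicOrUnicyclicComponents (restrict-restrict G X (∁ B)))
    (subst AcyclicOrUnicyclicComponents (sym (restrict-restrict G X (∁ B))) ∘ Equivalence.from Y⇔
      ∘ atMostUnicyclicComponents-cong (λ _ → ⇔.sym (∈-lift-∁⇔ G X B)))
    where
    Y⇔ : AcyclicOrUnicyclicComponents (restrict G (lift G X (∁ B))) ⇔
         AtMostUnicyclicComponents (_∈ lift G X (∁ B))
    Y⇔ = acyclicOrUnicyclicComponents⇔ (lift G X (∁ B))

-- Critical edge sets

module Critical {m : ℕ} (G : Graph m) (s : ℕ) where
  open Subgraphs G
  open Characterisation G

  Removal : Subset (length G) → Subset (length G) → Set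
  Removal X R = R ⊆ X × AtMostUnicyclicComponents (_∈ X ─ R)

  ExcessAbove : Subset (length G) → Set
  ExcessAbove X = ∀ R → Removal X R → suc s ≤ ∣ R ∣

  SmallRemoval : Subset (length G) → Set
  SmallRemoval X = ∃ λ R → Removal X R × ∣ R ∣ ≤ s

  excessAbove⊎smallRemoval : ∀ X → ExcessAbove X ⊎ SmallRemoval X
  excessAbove⊎smallRemoval X with anySubset? (λ R →
    (R ⊆? X ×-dec atMostUnicyclicComponents? (_∈? X ─ R)) ×-dec ∣ R ∣ ≤? s)
  ... | yes small = inj₂ small
  ... | no ∄small = inj₁ λ R removal → ≰⇒> λ ∣R∣≤s → ∄small (R , removal , ∣R∣≤s)

  excessAbove? : ∀ X → Dec (ExcessAbove X)
  excessAbove? X with excessAbove⊎smallRemoval X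
  ... | inj₁ above                  = yes above
  ... | inj₂ (R , removal , ∣R∣≤s) = no λ above → ≤⇒≯ ∣R∣≤s (above R removal)

  Critical : Subset (length G) → Set
  Critical K = ExcessAbove K × (∀ j → j ∈ K → SmallRemoval (K - j))

  critical-exists : ∀ X → ExcessAbove X → ∃ Critical
  critical-exists X = go X (⊂-wellFounded X)
    where
    go : ∀ X → Acc _⊂_ X → ExcessAbove X → ∃ Critical
    go X (acc smaller) above with any? (λ j → j ∈? X ×-dec excessAbove? (X - j))
    ... | yes (j , j∈X , above′) = go (X - j) (smaller (x∈p⇒p-x⊂p j∈X)) above′
    ... | no ∄above = X , above , λ j j∈X →
      [ (λ above′ → ⊥-elim (∄above (j , j∈X , above′))) , id ]′ (excessAbove⊎smallRemoval (X - j))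

  -- Putting j back into a repaired K ─ R - j never creates a component with two cycles.
  Redundant : Subset (length G) → Edge → Set
  Redundant K j = ∀ R → R ⊆ K → j ∉ R → AtMostUnicyclicComponents ((_∈ K ─ R) ∖ j) →
    AtMostUnicyclic (ComponentOf (_∈ K ─ R) (left j))

  critical⇒irredundant : ∀ {K j} → Critical K → j ∈ K → ¬ Redundant K j
  critical⇒irredundant {K} {j} (above , small) j∈K redundant with small j j∈K
  ... | R , (R⊆K-j , amuc) , ∣R∣≤s = ≤⇒≯ ∣R∣≤s (above R (R⊆K , amuc-restored))
    where
    R⊆K : R ⊆ K
    R⊆K = proj₁ ∘ Equivalence.to ∈-⇔ ∘ R⊆K-j
    j∉R : j ∉ R
    j∉R j∈R = proj₂ (Equivalence.to ∈-⇔ (R⊆K-j j∈R)) refl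
    amuc∖j : AtMostUnicyclicComponents ((_∈ K ─ R) ∖ j)
    amuc∖j = atMostUnicyclicComponents-cong (λ _ → ∈-⇔)
      (subst (λ L → AtMostUnicyclicComponents (_∈ L)) (p─q─r≡p─r─q K ⁅ j ⁆ R) amuc)
    amuc-restored : AtMostUnicyclicComponents (_∈ K ─ R)
    amuc-restored = atMostUnicyclicComponents-restore (_∈? K ─ R) (x∈p∧x∉q⇒x∈p─q j∈K j∉R)
      amuc∖j (redundant R R⊆K j∉R amuc∖j)

  leaf⇒redundant : ∀ {K j x y} → Joins (endsOf j) x y →
    (∀ i → i ∈ K → Ends (endsOf i) x → i ≡ j) → Redundant K j
  leaf⇒redundant {K} j-x-y x-leaf R _ _ =
    leaf-component-atMostUnicyclic j-x-y (λ i i∈ → x-leaf i (p─q⊆p K R i∈))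

  atMostUnicyclic⇒redundant : ∀ {K v j} → AtMostUnicyclic (ComponentOf (_∈ K) v) →
    ComponentOf (_∈ K) v j → Redundant K j
  atMostUnicyclic⇒redundant {K} amu (_ , v~j) R _ _ _ = atMostUnicyclic-anti
    (λ i (i∈ , j~i) → p─q⊆p K R i∈ , connected-trans v~j (connected-mono (λ _ → p─q⊆p K R) j~i))
    amu

  critical⇒leafless : ∀ {K} → Critical K → Leafless (restrict G K)
  critical⇒leafless {K} critical v degree≡1 with degree≡1⇒unique-end (restrict G K) v degree≡1
  ... | j , v-end , only-j =
    critical⇒irredundant critical (embed-∈ G K j) (leaf⇒redundant (proj₂ (ends⇒joins v-end′)) v-leaf)
    where
    v-end′ : Ends (endsOf (embed G K j)) v
    v-end′ = subst (λ e → Ends e v) (lookup-restrict G K j) v-end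
    v-leaf : ∀ i → i ∈ K → Ends (endsOf i) v → i ≡ embed G K j
    v-leaf i i∈K i-end with embed-surjective G K i∈K
    ... | i′ , refl =
      cong (embed G K) (only-j i′ (subst (λ e → Ends e v) (sym (lookup-restrict G K i′)) i-end))

  critical⇒cyclomatic≥2 : ∀ {K} → Critical K →
    ∀ v C → IsComponent (restrict G K) v C → Nonempty C →
    ∃[ k ] (IsCyclomaticNumber (restrict (restrict G K) C) k × 2 ≤ k)
  critical⇒cyclomatic≥2 {K} critical v C component (j , j∈C)
    with cyclomaticNumber-exists (restrict (restrict G K) C)
  ... | k , cn with 2 ≤? k
  ...   | yes 2≤k = k , cn , 2≤k
  ...   | no 2≰k =
    ⊥-elim (critical⇒irredundant critical (proj₁ j-in) (atMostUnicyclic⇒redundant amu j-in))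
    where
    amu : AtMostUnicyclic (ComponentOf (_∈ K) v)
    amu = atMostUnicyclic-anti (λ _ → Equivalence.from (∈-lift-component⇔ K component))
      (Equivalence.to (cyclomatic≤1⇔atMostUnicyclic (lift G K C))
        (k , subst (λ H → IsCyclomaticNumber H k) (restrict-restrict G K C) cn , ≤-pred (≰⇒> 2≰k)))
    j-in : ComponentOf (_∈ K) v (embed G K j)
    j-in = Equivalence.to (∈-lift-component⇔ K component) (embed-∈-lift G K C j∈C)

  excessAbove⇒nonempty : ∀ {K} → ExcessAbove K → Nonempty K
  excessAbove⇒nonempty {K} above with nonempty? K
  ... | yes nonempty = nonempty
  ... | no ∄ = ⊥-elim (≤⇒≯ z≤n (subst (suc s ≤_) (∣⊥∣≡0 (length G)) (above ⊥ (⊥⊆ , inj₁ ∘ no-cycle))))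
    where
    no-cycle : ∀ v → ¬ HasCycleIn (ComponentOf (_∈ K ─ ⊥) v)
    no-cycle _ (_ , []    , ne , _)                    = ne refl
    no-cycle _ (_ , i ∷ _ , _  , _ , _ , (i∈ , _) ∷ _) = ∄ (i , p─q⊆p K ⊥ i∈)

  -- Restoring an edge j to K - j is paid for by adding j to the removal set.
  critical⇒removal : ∀ {K} → Critical K → ∃ λ R → Removal K R × ∣ R ∣ ≡ suc s
  critical⇒removal {K} (above , small) with excessAbove⇒nonempty above
  ... | j , j∈K with small j j∈K
  ...   | R , (R⊆K-j , amuc) , ∣R∣≤s = R′ , removal , ≤-antisym ∣R′∣≤1+s (above R′ removal)
    where
    R′ : Subset (length G)
    R′ = R ∪ ⁅ j ⁆
    R′⊆K : R′ ⊆ K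
    R′⊆K i∈ with x∈p∪q⁻ R ⁅ j ⁆ i∈
    ... | inj₁ i∈R = proj₁ (Equivalence.to ∈-⇔ (R⊆K-j i∈R))
    ... | inj₂ i∈j = subst (_∈ K) (sym (x∈⁅y⁆⇒x≡y j i∈j)) j∈K
    removal : Removal K R′
    removal = R′⊆K , subst (λ L → AtMostUnicyclicComponents (_∈ L))
      (trans (p─q─r≡p─r─q K ⁅ j ⁆ R) (p─q─r≡p─q∪r K R ⁅ j ⁆)) amuc
    ∣R′∣≤1+s : ∣ R′ ∣ ≤ suc s
    ∣R′∣≤1+s = ≤-trans (∣p∪q∣≤∣p∣+∣q∣ R ⁅ j ⁆)
      (≤-trans (+-mono-≤ ∣R∣≤s (≤-reflexive (∣⁅x⁆∣≡1 j))) (≤-reflexive (+-comm s 1)))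

  critical⇒excess : ∀ {K} → Critical K → IsExcess (restrict G K) (suc s)
  critical⇒excess {K} critical@(above , _) with critical⇒removal critical
  ... | R , (R⊆K , amuc) , ∣R∣≡1+s = (B , ∣B∣≡1+s , aouc) , least
    where
    B : Subset (length (restrict G K))
    B = project G K R
    lift-B : lift G K B ≡ R
    lift-B = lift-project G K R R⊆K
    ∣B∣≡1+s : ∣ B ∣ ≡ suc s
    ∣B∣≡1+s = trans (sym (∣lift∣≡∣∣ G K B)) (trans (cong ∣_∣ lift-B) ∣R∣≡1+s)
    aouc : AcyclicOrUnicyclicComponents (restrict (restrict G K) (∁ B))
    aouc = Equivalence.from (acyclicOrUnicyclicComponents-restrict²⇔ K B)
      (subst (λ L → AtMostUnicyclicComponents (_∈ K ─ L)) (sym lift-B) amuc)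
    least : ∀ B′ → AcyclicOrUnicyclicComponents (restrict (restrict G K) (∁ B′)) → suc s ≤ ∣ B′ ∣
    least B′ aouc′ = subst (suc s ≤_) (∣lift∣≡∣∣ G K B′) (above (lift G K B′)
      (lift⊆ G K B′ , Equivalence.to (acyclicOrUnicyclicComponents-restrict²⇔ K B′) aouc′))

  excessAbove-⊤ : ∀ {k} → IsExcess G k → suc s ≤ k → ExcessAbove ⊤
  excessAbove-⊤ (_ , least) s<k R (_ , amuc) = ≤-trans s<k (least R
    (Equivalence.from (acyclicOrUnicyclicComponents⇔ (∁ R))
      (atMostUnicyclicComponents-cong ⊤─⇔∁ amuc)))
    where
    ⊤─⇔∁ : ∀ i → i ∈ ⊤ ─ R ⇔ i ∈ ∁ R
    ⊤─⇔∁ i = mk⇔ (x∉p⇒x∈∁p ∘ proj₂ ∘ Equivalence.to ∈─⇔)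
                 (λ i∈∁R → x∈p∧x∉q⇒x∈p─q ∈⊤ (x∈∁p⇒x∉p i∈∁R))

lemma9 : {U : Set} {m : ℕ} (S : List U) → Unique S → (h₁ h₂ : U → Fin m) →
    (s : ℕ) →
    (∃[ k ] (IsExcess (cuckooGraph S h₁ h₂) k × suc s ≤ k)) →
    Σ (Subset (length (cuckooGraph S h₁ h₂))) λ K →
      IsCoreGraph s (restrict (cuckooGraph S h₁ h₂) K)
lemma9 S _ h₁ h₂ s (k , excess , s<k) =
  let open Critical (cuckooGraph S h₁ h₂) s
      K , critical = critical-exists ⊤ (excessAbove-⊤ excess s<k)
  in K , critical⇒leafless critical , critical⇒excess critical , critical⇒cyclomatic≥2 critical
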